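{- Let $\phi,\psi\in\mathcal{L}_C$ and assume that the sequent $\vdash\phi,\psi$ is derivable in DBL. Then $\vdash_C\phi$ or $\vdash_C\psi$.
   Context: Fix a finite set $\Theta$ of atomic propositions and $\theta_1\in\Theta$. $\mathcal{L}$ is the smallest set containing $\Theta$ and closed under $\neg\phi$, $\phi\rightarrow\psi$, $(\psi|\phi)$; $\mathcal{L}_C\subset\mathcal{L}$ is the smallest set containing $\Theta$ and closed under $\neg$ and $\rightarrow$ only. Abbreviations: $\phi\vee\psi:=\neg\phi\rightarrow\psi$, $\phi\wedge\psi:=\neg(\neg\phi\vee\neg\psi)$, $\phi\leftrightarrow\psi:=(\phi\rightarrow\psi)\wedge(\psi\rightarrow\phi)$, $\psi\times\phi:=(\psi|\phi)\leftrightarrow\psi$, $\top:=\theta_1\rightarrow\theta_1$, $\bot:=\neg\top$. A sequent is a pair of finite (possibly empty) sequences $\Gamma,\Delta$ of formulas, written $\Gamma\vdash\Delta$ (the right side lists alternatives, not a disjunction); $\{\Gamma\}$ is the set of entries of $\Gamma$. The classical system $\mathcal{C}$ is the smallest set of sequents closed under (CUT) from $\Gamma\vdash\Delta,\phi$ and $\Lambda,\phi\vdash\Sigma$ infer $\Gamma,\Lambda\vdash\Delta,\Sigma$, and (STRUCT) if $\{\Gamma\}\subset\{\Lambda\}\cup\{\top\}$, $\{\Delta\}\subset\{\Sigma\}\cup\{\bot\}$, from $\Gamma\vdash\Delta$ infer $\Lambda\vdash\Sigma$, and containing for all $\phi,\psi,\eta$: $\phi,\phi\rightarrow\psi\vdash\psi$;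 $\vdash\phi\rightarrow(\psi\rightarrow\phi)$; $\vdash(\eta\rightarrow(\phi\rightarrow\psi))\rightarrow((\eta\rightarrow\phi)\rightarrow(\eta\rightarrow\psi))$; $\vdash(\neg\phi\rightarrow\neg\psi)\rightarrow((\neg\phi\rightarrow\psi)\rightarrow\phi)$; derivability in it is written $\vdash_C$. DBL is the smallest set of sequents with the same closure conditions and axioms, and additionally containing for all $\phi,\psi,\eta$: $\phi\rightarrow\psi\vdash\neg\phi,(\psi|\phi)$; $\vdash(\psi\rightarrow\eta|\phi)\rightarrow((\psi|\phi)\rightarrow(\eta|\phi))$; $\vdash(\psi|\phi)\rightarrow(\phi\rightarrow\psi)$; $\vdash\neg(\neg\psi|\phi)\leftrightarrow(\psi|\phi)$; $\psi\times\phi\vdash\phi\times\psi$. -}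

module Defs where

open import Data.Nat using (ℕ; suc)
open import Data.Fin using (Fin; zero)
open import Data.List using (List; []; _∷_; _++_)
open import Data.List.Membership.Propositional using (_∈_)
open import Data.Sum using (_⊎_)
open import Relation.Binary.PropositionalEquality using (_≡_)

module Logic (n : ℕ) where

  Atom : Set
  Atom = Fin (suc n)

  θ₁ : Atom
  θ₁ = zero

  data Form : Set where
    atom : Atom → Form
    ¬_   : Form → Form
    _⇒_  : Form → Form → Form
    _∣_  : Form → Form → Form

  infixr 5 _⇒_
  infix 7 ¬_

  data Classical : Form → Set where
    c-atom : ∀ a → Classical (atom a)
    c-neg  : ∀ {φ} → Classical φ → Classical (¬ φ)
    c-imp  : ∀ {φ ψ} → Classical φ → Classical ψ → Classical (φ ⇒ ψ)

  _∨_ : Form → Form → Form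
  φ ∨ ψ = (¬ φ) ⇒ ψ

  _∧_ : Form → Form → Form
  φ ∧ ψ = ¬ ((¬ φ) ∨ (¬ ψ))

  _⇔_ : Form → Form → Form
  φ ⇔ ψ = (φ ⇒ ψ) ∧ (ψ ⇒ φ)

  _×ᶜ_ : Form → Form → Form
  ψ ×ᶜ φ = (ψ ∣ φ) ⇔ ψ

  ⊤ᶠ : Form
  ⊤ᶠ = atom θ₁ ⇒ atom θ₁

  ⊥ᶠ : Form
  ⊥ᶠ = ¬ ⊤ᶠ

  _⊆_∪[_] : List Form → List Form → Form → Set
  Γ ⊆ Λ ∪[ x ] = ∀ {χ} → χ ∈ Γ → χ ∈ Λ ⊎ χ ≡ x

  data ⊢C : List Form → List Form → Set where
    cut    : ∀ {Γ Δ Λ Σ φ} → ⊢C Γ (Δ ++ φ ∷ []) → ⊢C (Λ ++ φ ∷ []) Σ → ⊢C (Γ ++ Λ) (Δ ++ Σ)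
    struct : ∀ {Γ Δ Λ Σ} → Γ ⊆ Λ ∪[ ⊤ᶠ ] → Δ ⊆ Σ ∪[ ⊥ᶠ ] → ⊢C Γ Δ → ⊢C Λ Σ
    mp     : ∀ {φ ψ} → ⊢C (φ ∷ (φ ⇒ ψ) ∷ []) (ψ ∷ [])
    ax1    : ∀ {φ ψ} → ⊢C [] ((φ ⇒ (ψ ⇒ φ)) ∷ [])
    ax2    : ∀ {φ ψ η} → ⊢C [] (((η ⇒ (φ ⇒ ψ)) ⇒ ((η ⇒ φ) ⇒ (η ⇒ ψ))) ∷ [])
    ax3    : ∀ {φ ψ} → ⊢C [] ((((¬ φ) ⇒ (¬ ψ)) ⇒ (((¬ φ) ⇒ ψ) ⇒ φ)) ∷ [])

  data ⊢DBL : List Form → List Form → Set where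
    cut    : ∀ {Γ Δ Λ Σ φ} → ⊢DBL Γ (Δ ++ φ ∷ []) → ⊢DBL (Λ ++ φ ∷ []) Σ → ⊢DBL (Γ ++ Λ) (Δ ++ Σ)
    struct : ∀ {Γ Δ Λ Σ} → Γ ⊆ Λ ∪[ ⊤ᶠ ] → Δ ⊆ Σ ∪[ ⊥ᶠ ] → ⊢DBL Γ Δ → ⊢DBL Λ Σ
    mp     : ∀ {φ ψ} → ⊢DBL (φ ∷ (φ ⇒ ψ) ∷ []) (ψ ∷ [])
    ax1    : ∀ {φ ψ} → ⊢DBL [] ((φ ⇒ (ψ ⇒ φ)) ∷ [])
    ax2    : ∀ {φ ψ η} → ⊢DBL [] (((η ⇒ (φ ⇒ ψ)) ⇒ ((η ⇒ φ) ⇒ (η ⇒ ψ))) ∷ [])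
    ax3    : ∀ {φ ψ} → ⊢DBL [] ((((¬ φ) ⇒ (¬ ψ)) ⇒ (((¬ φ) ⇒ ψ) ⇒ φ)) ∷ [])
    dbl1   : ∀ {φ ψ} → ⊢DBL ((φ ⇒ ψ) ∷ []) ((¬ φ) ∷ (ψ ∣ φ) ∷ [])
    dbl2   : ∀ {φ ψ η} → ⊢DBL [] ((((ψ ⇒ η) ∣ φ) ⇒ ((ψ ∣ φ) ⇒ (η ∣ φ))) ∷ [])
    dbl3   : ∀ {φ ψ} → ⊢DBL [] (((ψ ∣ φ) ⇒ (φ ⇒ ψ)) ∷ [])
    dbl4   : ∀ {φ ψ} → ⊢DBL [] (((¬ ((¬ ψ) ∣ φ)) ⇔ (ψ ∣ φ)) ∷ [])
    dbl5   : ∀ {φ ψ} → ⊢DBL ((ψ ×ᶜ φ) ∷ []) ((φ ×ᶜ ψ) ∷ [])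

{-# OPTIONS --safe #-}
-- DBL is sound for two-world models in which (ψ | φ) is read at the nearest
-- φ-world.  There classical formulas are evaluated world by world, and ψ × φ
-- holds iff φ or ψ takes the same value in both worlds, a condition symmetric
-- in φ and ψ (this is what makes dbl5 sound).  If neither φ nor ψ were a
-- theorem of 𝒞, Kalmár's completeness argument would give valuations v₁, v₂
-- falsifying φ and ψ respectively; the model with worlds v₁ and v₂ refutes
-- both, contradicting the soundness of ⊢ φ , ψ.
module Submission where

open import Defs
open import Data.Nat using (ℕ; suc)
open import Data.List using ([]; _∷_)
open import Data.Sum using (_⊎_)

open import Data.Bool using (Bool; true; false; not)
open import Data.Bool.Properties using (not-involutive; ¬-not) renaming (_≟_ to _≟ᵇ_)
open import Data.Empty using (⊥; ⊥-elim)
open import Data.Fin using (_≟_)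
open import Data.Fin.Subset.Properties using (anySubset?)
open import Data.List using (List; map; allFin)
open import Data.List.Membership.Propositional using (_∈_; find; lose)
open import Data.List.Membership.Propositional.Properties using (∈-map⁺; ∈-map⁻; ∈-allFin)
open import Data.List.Relation.Binary.Subset.Propositional using (_⊆_)
open import Data.List.Relation.Unary.All as All using (All; []; _∷_)
open import Data.List.Relation.Unary.All.Properties as All using ()
open import Data.List.Relation.Unary.Any using (Any; here; there)
open import Data.List.Relation.Unary.Any.Properties as Any using ()
open import Data.Product using (∃; _,_)
open import Data.Sum using (inj₁; inj₂; [_,_]′; swap)
open import Data.Vec using (Vec; lookup; replicate; _[_]≔_)
open import Data.Vec.Properties using (lookup∘update; lookup∘update′)
open import Function using (id; _∘_)
open import Relation.Nullary.Decidable using (yes; no)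
open import Relation.Binary.PropositionalEquality using (_≡_; refl; sym; trans; cong; cong₂; subst)

infixr 5 _→ᵇ_

_→ᵇ_ : Bool → Bool → Bool
true  →ᵇ b = b
false →ᵇ _ = true

→ᵇ-intro : ∀ a {b} → (a ≡ true → b ≡ true) → a →ᵇ b ≡ true
→ᵇ-intro true  f = f refl
→ᵇ-intro false _ = refl

→ᵇ-elim : ∀ {a b} → a →ᵇ b ≡ true → a ≡ true → b ≡ true
→ᵇ-elim h refl = h

false≢true : false ≡ true → ⊥
false≢true ()

data World : Set where
  w₁ w₂ : World

other : World → World
other w₁ = w₂
other w₂ = w₁

nearest : Bool → Bool → World → World
nearest false true w = other w
nearest _     _    w = w

world-cases : ∀ u w → u ≡ w ⊎ u ≡ other w
world-cases w₁ w₁ = inj₁ refl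
world-cases w₁ w₂ = inj₂ refl
world-cases w₂ w₁ = inj₂ refl
world-cases w₂ w₂ = inj₁ refl

nearest-satisfies : ∀ (P : World → Bool) {u} w → P u ≡ true →
                    P (nearest (P w) (P (other w)) w) ≡ true
nearest-satisfies P {u} w Pu with P w in Pw | P (other w) in Pw′ | world-cases u w
... | true  | _     | _         = Pw
... | false | true  | _         = Pw′
... | false | false | inj₁ refl = ⊥-elim (false≢true (trans (sym Pw) Pu))
... | false | false | inj₂ refl = ⊥-elim (false≢true (trans (sym Pw′) Pu))

nearest-diag : ∀ b w → nearest b b w ≡ w
nearest-diag true  w = refl
nearest-diag false w = refl

module _ {n : ℕ} where
  open Logic n

  variable
    a   : Atom
    b c : Bool
    φ ψ η : Form
    Γ Δ Λ : List Form
    L   : List Atom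

  -- A subset of the atoms, so that anySubset? ranges over all valuations.
  Valuation : Set
  Valuation = Vec Bool (suc n)

  eval : Valuation → Form → Bool
  eval v (atom a) = lookup v a
  eval v (¬ φ)    = not (eval v φ)
  eval v (φ ⇒ ψ)  = eval v φ →ᵇ eval v ψ
  eval v (ψ ∣ φ)  = eval v ψ   -- arbitrary: eval is only used on ℒ_C

  Tautology Falsifiable : Form → Set
  Tautology φ   = ∀ v → eval v φ ≡ true
  Falsifiable φ = ∃ λ v → eval v φ ≡ false

  tautology-or-falsifiable : ∀ φ → Tautology φ ⊎ Falsifiable φ
  tautology-or-falsifiable φ with anySubset? (λ v → eval v φ ≟ᵇ false)
  ... | yes falsified = inj₂ falsified
  ... | no unfalsified = inj₁ λ v → ¬-not λ eq → unfalsified (v , eq)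

  infix 3 _⊢_

  data _⊢_ (Γ : List Form) : Form → Set where
    hyp    : φ ∈ Γ → Γ ⊢ φ
    axK    : Γ ⊢ φ ⇒ ψ ⇒ φ
    axS    : Γ ⊢ (η ⇒ φ ⇒ ψ) ⇒ (η ⇒ φ) ⇒ η ⇒ ψ
    axN    : Γ ⊢ (¬ φ ⇒ ¬ ψ) ⇒ (¬ φ ⇒ ψ) ⇒ φ
    ⇒-elim : Γ ⊢ φ ⇒ ψ → Γ ⊢ φ → Γ ⊢ ψ

  weaken : Γ ⊆ Δ → Γ ⊢ φ → Δ ⊢ φ
  weaken Γ⊆Δ (hyp φ∈Γ)   = hyp (Γ⊆Δ φ∈Γ)
  weaken Γ⊆Δ axK         = axK
  weaken Γ⊆Δ axS         = axS
  weaken Γ⊆Δ axN         = axN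
  weaken Γ⊆Δ (⇒-elim d e) = ⇒-elim (weaken Γ⊆Δ d) (weaken Γ⊆Δ e)

  wk : Γ ⊢ φ → ψ ∷ Γ ⊢ φ
  wk = weaken there

  top : φ ∷ Γ ⊢ φ
  top = hyp (here refl)

  ⇒-refl : Γ ⊢ φ ⇒ φ
  ⇒-refl {φ = φ} = ⇒-elim (⇒-elim axS (axK {ψ = φ ⇒ φ})) (axK {ψ = φ})

  deduction : φ ∷ Γ ⊢ ψ → Γ ⊢ φ ⇒ ψ
  deduction (hyp (here refl)) = ⇒-refl
  deduction (hyp (there ψ∈Γ)) = ⇒-elim axK (hyp ψ∈Γ)
  deduction axK               = ⇒-elim axK axK
  deduction axS               = ⇒-elim axK axS
  deduction axN               = ⇒-elim axK axN
  deduction (⇒-elim d e)      = ⇒-elim (⇒-elim axS (deduction d)) (deduction e)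

  by-contradiction : ¬ φ ∷ Γ ⊢ ψ → ¬ φ ∷ Γ ⊢ ¬ ψ → Γ ⊢ φ
  by-contradiction d e = ⇒-elim (⇒-elim axN (deduction e)) (deduction d)

  ¬¬-elim : Γ ⊢ ¬ ¬ φ → Γ ⊢ φ
  ¬¬-elim d = by-contradiction top (wk d)

  ¬¬-intro : Γ ⊢ φ → Γ ⊢ ¬ ¬ φ
  ¬¬-intro d = by-contradiction (wk d) (¬¬-elim top)

  explosion : Γ ⊢ ¬ φ → Γ ⊢ φ → Γ ⊢ ψ
  explosion d e = by-contradiction (wk e) (wk d)

  ¬⇒-intro : Γ ⊢ φ → Γ ⊢ ¬ ψ → Γ ⊢ ¬ (φ ⇒ ψ)
  ¬⇒-intro d e = by-contradiction (⇒-elim (¬¬-elim top) (wk d)) (wk e)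

  excluded-middle : φ ∷ Γ ⊢ ψ → ¬ φ ∷ Γ ⊢ ψ → Γ ⊢ ψ
  excluded-middle {φ = φ} {Γ = Γ} {ψ = ψ} d e = by-contradiction ¬ψ⊢φ ¬ψ⊢¬φ
    where
    ¬ψ⊢φ : ¬ ψ ∷ Γ ⊢ φ
    ¬ψ⊢φ  = by-contradiction (⇒-elim (wk (wk (deduction e))) top) (wk top)
    ¬ψ⊢¬φ : ¬ ψ ∷ Γ ⊢ ¬ φ
    ¬ψ⊢¬φ = by-contradiction (⇒-elim (wk (wk (deduction d))) (¬¬-elim top)) (wk top)

  ⊢C-mp : ⊢C [] (φ ∷ []) → ⊢C [] ((φ ⇒ ψ) ∷ []) → ⊢C [] (ψ ∷ [])
  ⊢C-mp ⊢φ ⊢φ⇒ψ =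
    cut {Γ = []} {Δ = []} {Λ = []} ⊢φ (cut {Γ = []} {Δ = []} {Λ = _ ∷ []} ⊢φ⇒ψ mp)

  closed⇒⊢C : [] ⊢ φ → ⊢C [] (φ ∷ [])
  closed⇒⊢C (hyp ())
  closed⇒⊢C axK          = ax1
  closed⇒⊢C axS          = ax2
  closed⇒⊢C axN          = ax3
  closed⇒⊢C (⇒-elim d e) = ⊢C-mp (closed⇒⊢C e) (closed⇒⊢C d)

  infix 8 _^_

  _^_ : Form → Bool → Form
  φ ^ true  = φ
  φ ^ false = ¬ φ

  ¬-^ : Γ ⊢ φ ^ b → Γ ⊢ (¬ φ) ^ not b
  ¬-^ {b = true}  d = ¬¬-intro d
  ¬-^ {b = false} d = d

  ⇒-^ : Γ ⊢ φ ^ b → Γ ⊢ ψ ^ c → Γ ⊢ (φ ⇒ ψ) ^ (b →ᵇ c)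
  ⇒-^ {b = false}            d _ = deduction (explosion (wk d) top)
  ⇒-^ {b = true} {c = true}  _ e = ⇒-elim axK e
  ⇒-^ {b = true} {c = false} d e = ¬⇒-intro d e

  literal : Valuation → Atom → Form
  literal v a = atom a ^ lookup v a

  kalmar : ∀ {v} → (∀ a → literal v a ∈ Γ) → Classical φ → Γ ⊢ φ ^ eval v φ
  kalmar literals∈Γ (c-atom a)  = hyp (literals∈Γ a)
  kalmar literals∈Γ (c-neg c)   = ¬-^ (kalmar literals∈Γ c)
  kalmar literals∈Γ (c-imp c d) = ⇒-^ (kalmar literals∈Γ c) (kalmar literals∈Γ d)

  literals : Valuation → List Atom → List Form
  literals v = map (literal v)

  literals-update-⊆ : ∀ v → literals (v [ a ]≔ c) (a ∷ L) ⊆ atom a ^ c ∷ literals v L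
  literals-update-⊆ {a} {c} v χ∈ with ∈-map⁻ (literal (v [ a ]≔ c)) χ∈
  ... | b , b∈a∷L , refl with b ≟ a | b∈a∷L
  ...   | yes refl | _           = here (cong (atom b ^_) (lookup∘update b v c))
  ...   | no b≢a   | here b≡a    = ⊥-elim (b≢a b≡a)
  ...   | no b≢a   | there b∈L   =
    there (subst (_∈ _) (cong (atom b ^_) (sym (lookup∘update′ b≢a v c)))
                 (∈-map⁺ (literal v) b∈L))

  drop-literal : (∀ v → literals v (a ∷ L) ⊢ φ) → ∀ v → literals v L ⊢ φ
  drop-literal {a} h v =
    excluded-middle (weaken (literals-update-⊆ v) (h (v [ a ]≔ true)))
                    (weaken (literals-update-⊆ v) (h (v [ a ]≔ false)))

  drop-literals : ∀ L → (∀ v → literals v L ⊢ φ) → [] ⊢ φ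
  drop-literals []      h = h (replicate _ true)
  drop-literals (a ∷ L) h = drop-literals L (drop-literal h)

  weak-completeness : Classical φ → Tautology φ → ⊢C [] (φ ∷ [])
  weak-completeness {φ} c ⊨φ = closed⇒⊢C (drop-literals (allFin _) all-literals⊢φ)
    where
    all-literals⊢φ : ∀ v → literals v (allFin _) ⊢ φ
    all-literals⊢φ v =
      subst (λ b → _ ⊢ φ ^ b) (⊨φ v) (kalmar (λ a → ∈-map⁺ (literal v) (∈-allFin a)) c)

  module TwoWorld (v₁ v₂ : Valuation) where

    val : World → Valuation
    val w₁ = v₁
    val w₂ = v₂

    -- (ψ | φ) is read at the nearest φ-world: w itself if φ holds at w or at
    -- neither world, the other world otherwise.
    ⟦_⟧    : Form → World → Bool
    select : Form → World → World

    ⟦ atom a ⟧ w = lookup (val w) a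
    ⟦ ¬ φ ⟧    w = not (⟦ φ ⟧ w)
    ⟦ φ ⇒ ψ ⟧  w = ⟦ φ ⟧ w →ᵇ ⟦ ψ ⟧ w
    ⟦ ψ ∣ φ ⟧  w = ⟦ ψ ⟧ (select φ w)

    select φ w = nearest (⟦ φ ⟧ w) (⟦ φ ⟧ (other w)) w

    Holds : Form → Set
    Holds φ = ∀ w → ⟦ φ ⟧ w ≡ true

    Valid : List Form → List Form → Set
    Valid Γ Δ = All Holds Γ → Any Holds Δ

    ⊤-holds : Holds ⊤ᶠ
    ⊤-holds w = →ᵇ-intro (⟦ atom θ₁ ⟧ w) id

    ⊥-fails : Holds ⊥ᶠ → ⊥
    ⊥-fails ⊨⊥ = false≢true (trans (sym (cong not (⊤-holds w₁))) (⊨⊥ w₁))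

    classical-pointwise : ∀ {w} → Classical φ → ⟦ φ ⟧ w ≡ eval (val w) φ
    classical-pointwise (c-atom a)  = refl
    classical-pointwise (c-neg c)   = cong not (classical-pointwise c)
    classical-pointwise (c-imp c d) = cong₂ _→ᵇ_ (classical-pointwise c) (classical-pointwise d)

    refuted : ∀ w → Classical φ → eval (val w) φ ≡ false → Holds φ → ⊥
    refuted w c φ✗ ⊨φ = false≢true (trans (sym φ✗) (trans (sym (classical-pointwise c)) (⊨φ w)))

    ⇔-intro : ∀ φ ψ w → ⟦ φ ⟧ w ≡ ⟦ ψ ⟧ w → ⟦ φ ⇔ ψ ⟧ w ≡ true
    ⇔-intro φ ψ w eq rewrite eq with ⟦ ψ ⟧ w
    ... | true  = refl
    ... | false = refl

    ⇔-elim : ∀ φ ψ w → ⟦ φ ⇔ ψ ⟧ w ≡ true → ⟦ φ ⟧ w ≡ ⟦ ψ ⟧ w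
    ⇔-elim φ ψ w with ⟦ φ ⟧ w | ⟦ ψ ⟧ w
    ... | true  | true  = λ _ → refl
    ... | false | false = λ _ → refl
    ... | true  | false = λ ()
    ... | false | true  = λ ()

    select-self : ∀ φ {w} → ⟦ φ ⟧ w ≡ true → select φ w ≡ w
    select-self φ {w} φw = cong (λ b → nearest b (⟦ φ ⟧ (other w)) w) φw

    select-other : ∀ φ {w} → ⟦ φ ⟧ w ≡ false → ⟦ φ ⟧ (other w) ≡ true → select φ w ≡ other w
    select-other φ {w} φw φw′ = cong₂ (λ b b′ → nearest b b′ w) φw φw′

    select-satisfies : ∀ φ {u} w → ⟦ φ ⟧ u ≡ true → ⟦ φ ⟧ (select φ w) ≡ true
    select-satisfies φ = nearest-satisfies ⟦ φ ⟧

    Rigid : Form → Set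
    Rigid φ = ∀ u w → ⟦ φ ⟧ u ≡ ⟦ φ ⟧ w

    rigid : ∀ φ → ⟦ φ ⟧ w₁ ≡ ⟦ φ ⟧ w₂ → Rigid φ
    rigid φ eq w₁ w₁ = refl
    rigid φ eq w₁ w₂ = eq
    rigid φ eq w₂ w₁ = sym eq
    rigid φ eq w₂ w₂ = refl

    select-rigid : ∀ φ → Rigid φ → ∀ w → select φ w ≡ w
    select-rigid φ φ-rigid w =
      trans (cong (λ b → nearest (⟦ φ ⟧ w) b w) (φ-rigid (other w) w)) (nearest-diag (⟦ φ ⟧ w) w)

    Independent : Form → Form → Set
    Independent ψ φ = ∀ w → ⟦ ψ ⟧ (select φ w) ≡ ⟦ ψ ⟧ w

    independent⇒rigid : ∀ ψ φ → Independent ψ φ → Rigid φ ⊎ Rigid ψ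
    independent⇒rigid ψ φ indep with ⟦ φ ⟧ w₁ in φ₁ | ⟦ φ ⟧ w₂ in φ₂
    ... | true  | true  = inj₁ (rigid φ (trans φ₁ (sym φ₂)))
    ... | false | false = inj₁ (rigid φ (trans φ₁ (sym φ₂)))
    ... | true  | false =
      inj₂ (rigid ψ (trans (cong ⟦ ψ ⟧ (sym (select-other φ φ₂ φ₁))) (indep w₂)))
    ... | false | true  =
      inj₂ (rigid ψ (sym (trans (cong ⟦ ψ ⟧ (sym (select-other φ φ₁ φ₂))) (indep w₁))))

    rigid⇒independent : ∀ ψ φ → Rigid φ ⊎ Rigid ψ → Independent ψ φ
    rigid⇒independent ψ φ (inj₁ φ-rigid) w = cong ⟦ ψ ⟧ (select-rigid φ φ-rigid w)
    rigid⇒independent ψ φ (inj₂ ψ-rigid) w = ψ-rigid _ w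

    ×ᶜ-sym : ∀ ψ φ → Holds (ψ ×ᶜ φ) → Holds (φ ×ᶜ ψ)
    ×ᶜ-sym ψ φ ψ×φ w = ⇔-intro (φ ∣ ψ) φ w (φ-independent-of-ψ w)
      where
      φ-independent-of-ψ : Independent φ ψ
      φ-independent-of-ψ =
        rigid⇒independent φ ψ (swap (independent⇒rigid ψ φ λ u → ⇔-elim (ψ ∣ φ) ψ u (ψ×φ u)))

    ax3-holds : ∀ φ ψ → Holds ((¬ φ ⇒ ¬ ψ) ⇒ (¬ φ ⇒ ψ) ⇒ φ)
    ax3-holds φ ψ w with ⟦ φ ⟧ w | ⟦ ψ ⟧ w
    ... | true  | _     = refl
    ... | false | true  = refl
    ... | false | false = refl

    conditional-of-satisfiable : ∀ φ ψ {u} → Holds (φ ⇒ ψ) → ⟦ φ ⟧ u ≡ true → Holds (ψ ∣ φ)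
    conditional-of-satisfiable φ ψ φ⇒ψ φu w = →ᵇ-elim (φ⇒ψ (select φ w)) (select-satisfies φ w φu)

    dbl1-holds : ∀ φ ψ → Holds (φ ⇒ ψ) → Holds (¬ φ) ⊎ Holds (ψ ∣ φ)
    dbl1-holds φ ψ φ⇒ψ with ⟦ φ ⟧ w₁ in φ₁ | ⟦ φ ⟧ w₂ in φ₂
    ... | true  | _     = inj₂ (conditional-of-satisfiable φ ψ φ⇒ψ φ₁)
    ... | false | true  = inj₂ (conditional-of-satisfiable φ ψ φ⇒ψ φ₂)
    ... | false | false = inj₁ λ { w₁ → cong not φ₁ ; w₂ → cong not φ₂ }

    dbl3-holds : ∀ φ ψ → Holds ((ψ ∣ φ) ⇒ φ ⇒ ψ)
    dbl3-holds φ ψ w =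
      →ᵇ-intro (⟦ ψ ∣ φ ⟧ w) λ ψ-at-select → →ᵇ-intro (⟦ φ ⟧ w) λ φw →
      subst (λ u → ⟦ ψ ⟧ u ≡ true) (select-self φ φw) ψ-at-select

    all-⊆∪⊤ : Γ ⊆ Λ ∪[ ⊤ᶠ ] → All Holds Λ → All Holds Γ
    all-⊆∪⊤ Γ⊆Λ∪⊤ ⊨Λ =
      All.tabulate λ χ∈Γ → [ All.lookup ⊨Λ , (λ { refl → ⊤-holds }) ]′ (Γ⊆Λ∪⊤ χ∈Γ)

    any-⊆∪⊥ : Δ ⊆ Λ ∪[ ⊥ᶠ ] → Any Holds Δ → Any Holds Λ
    any-⊆∪⊥ Δ⊆Λ∪⊥ ⊨Δ with find ⊨Δ
    ... | χ , χ∈Δ , ⊨χ with Δ⊆Λ∪⊥ χ∈Δ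
    ...   | inj₁ χ∈Λ = lose χ∈Λ ⊨χ
    ...   | inj₂ refl = ⊥-elim (⊥-fails ⊨χ)

    sound : ⊢DBL Γ Δ → Valid Γ Δ
    sound (cut {Γ} {Δ} d e) ⊨ΓΛ with Any.++⁻ Δ (sound d (All.++⁻ˡ Γ ⊨ΓΛ))
    ... | inj₁ ⊨Δ        = Any.++⁺ˡ ⊨Δ
    ... | inj₂ (here ⊨φ) = Any.++⁺ʳ Δ (sound e (All.++⁺ (All.++⁻ʳ Γ ⊨ΓΛ) (⊨φ ∷ [])))
    sound (struct Γ⊆Λ∪⊤ Δ⊆Σ∪⊥ d) ⊨Λ = any-⊆∪⊥ Δ⊆Σ∪⊥ (sound d (all-⊆∪⊤ Γ⊆Λ∪⊤ ⊨Λ))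
    sound mp (⊨φ ∷ ⊨φ⇒ψ ∷ []) = here λ w → →ᵇ-elim (⊨φ⇒ψ w) (⊨φ w)
    sound (ax1 {φ} {ψ}) [] = here λ w → →ᵇ-intro (⟦ φ ⟧ w) λ φw → →ᵇ-intro (⟦ ψ ⟧ w) λ _ → φw
    sound (ax2 {φ} {ψ} {η}) [] = here λ w →
      →ᵇ-intro (⟦ η ⇒ φ ⇒ ψ ⟧ w) λ η⇒φ⇒ψ → →ᵇ-intro (⟦ η ⇒ φ ⟧ w) λ η⇒φ →
      →ᵇ-intro (⟦ η ⟧ w) λ ηw → →ᵇ-elim (→ᵇ-elim η⇒φ⇒ψ ηw) (→ᵇ-elim η⇒φ ηw)
    sound (ax3 {φ} {ψ}) [] = here (ax3-holds φ ψ)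
    sound (dbl1 {φ} {ψ}) (⊨φ⇒ψ ∷ []) = [ here , there ∘ here ]′ (dbl1-holds φ ψ ⊨φ⇒ψ)
    sound (dbl2 {φ} {ψ} {η}) [] = here λ w →
      →ᵇ-intro (⟦ (ψ ⇒ η) ∣ φ ⟧ w) λ ψ⇒η-at-select →
      →ᵇ-intro (⟦ ψ ∣ φ ⟧ w) (→ᵇ-elim ψ⇒η-at-select)
    sound (dbl3 {φ} {ψ}) [] = here (dbl3-holds φ ψ)
    sound (dbl4 {φ} {ψ}) [] = here λ w → ⇔-intro (¬ (¬ ψ ∣ φ)) (ψ ∣ φ) w (not-involutive _)
    sound (dbl5 {φ} {ψ}) (⊨ψ×φ ∷ []) = here (×ᶜ-sym ψ φ ⊨ψ×φ)

  not-both-falsifiable : Classical φ → Classical ψ → ⊢DBL [] (φ ∷ ψ ∷ []) →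
                         Falsifiable φ → Falsifiable ψ → ⊥
  not-both-falsifiable cφ cψ ⊢φ,ψ (v₁ , φ✗) (v₂ , ψ✗) with TwoWorld.sound v₁ v₂ ⊢φ,ψ []
  ... | here ⊨φ         = TwoWorld.refuted v₁ v₂ w₁ cφ φ✗ ⊨φ
  ... | there (here ⊨ψ) = TwoWorld.refuted v₁ v₂ w₂ cψ ψ✗ ⊨ψ

proposition11 : (n : ℕ) → let open Logic n in
    (φ ψ : Form) → Classical φ → Classical ψ →
    ⊢DBL [] (φ ∷ ψ ∷ []) →
    ⊢C [] (φ ∷ []) ⊎ ⊢C [] (ψ ∷ [])
proposition11 n φ ψ cφ cψ ⊢φ,ψ with tautology-or-falsifiable φ | tautology-or-falsifiable ψ
... | inj₁ ⊨φ | _       = inj₁ (weak-completeness cφ ⊨φ)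
... | inj₂ _  | inj₁ ⊨ψ = inj₂ (weak-completeness cψ ⊨ψ)
... | inj₂ φ✗ | inj₂ ψ✗ = ⊥-elim (not-both-falsifiable cφ cψ ⊢φ,ψ φ✗ ψ✗)
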